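{- Let $t$ be an indeterminate and $s_3(u,v)=tu^2-(t^2+1)uv-tv^2$. Then the equation $s_3(u,v)=s_3(1,1)=-t^2-1$ has infinitely many solutions $(u,v)$ with $u,v$ in the ring $\mathbb{Z}\left[\tfrac{1}{2},t\right]$. -}

module Defs where

open import Data.Nat using (ℕ; zero; suc; _^_)
open import Data.Rational using (ℚ; 0ℚ; 1ℚ; _+_; _*_; -_)
open import Data.List using (List; []; _∷_; map)
open import Data.List.Relation.Unary.All using (All)
open import Data.Product using (Σ; _×_; _,_; proj₁; proj₂; ∃-syntax)
open import Relation.Binary.PropositionalEquality using (_≡_)

-- Polynomials in the indeterminate t with rational coefficients,
-- as coefficient lists (index i = coefficient of t^i).
Poly : Set
Poly = List ℚ

coeff : Poly → ℕ → ℚ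
coeff []      _       = 0ℚ
coeff (a ∷ p) zero    = a
coeff (a ∷ p) (suc i) = coeff p i

_≈P_ : Poly → Poly → Set
p ≈P q = ∀ i → coeff p i ≡ coeff q i

infix 4 _≈P_
infixl 6 _+P_ _-P_
infixl 7 _*P_

_+P_ : Poly → Poly → Poly
[]      +P q       = q
(a ∷ p) +P []      = a ∷ p
(a ∷ p) +P (b ∷ q) = (a + b) ∷ (p +P q)

negP : Poly → Poly
negP = map -_

_-P_ : Poly → Poly → Poly
p -P q = p +P negP q

_*P_ : Poly → Poly → Poly
[]      *P q = []
(a ∷ p) *P q = map (a *_) q +P (0ℚ ∷ (p *P q))

tP : Poly
tP = 0ℚ ∷ 1ℚ ∷ []

oneP : Poly
oneP = 1ℚ ∷ []

-- Z[1/2]: rationals whose (reduced) denominator is a power of 2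
Dyadic : ℚ → Set
Dyadic q = ∃[ k ] ℚ.denominatorℕ q ≡ 2 ^ k

-- membership in Z[1/2, t] = Z[1/2][t] ⊆ ℚ[t]
InZHalfT : Poly → Set
InZHalfT p = All Dyadic p

s3 : Poly → Poly → Poly
s3 u v = tP *P u *P u -P (tP *P tP +P oneP) *P u *P v -P tP *P v *P v

target : Poly
target = s3 oneP oneP

IsSolution : Poly × Poly → Set
IsSolution (u , v) = InZHalfT u × InZHalfT v × s3 u v ≈P target

_≈²_ : Poly × Poly → Poly × Poly → Set
x ≈² y = (proj₁ x ≈P proj₁ y) × (proj₂ x ≈P proj₂ y)

-- "infinitely many solutions": an injective sequence of solutions
InfinitelyMany : (Poly × Poly → Set) → Set
InfinitelyMany P = Σ (ℕ → Poly × Poly) λ f →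
  (∀ n → P (f n)) × (∀ m n → f m ≈² f n → m ≡ n)

-- Over ℚ[t] the form s₃ has discriminant t⁴ + 6t² + 1, and X = (t²+1)(t²+5)/2, Y = (t²+3)/2
-- solve X² − (t⁴ + 6t² + 1) Y² = 4. The automorph of s₃ attached to this solution is
--   M = ½ [[(t²+1)(t²+4), t(t²+3)], [t(t²+3), t²+1]]   (determinant 1),
-- whose entries lie in ℤ[½, t]. Hence the orbit of (1, 1) under M consists of solutions.
-- At t = 0, M is diag(2, ½), so the constant term of the first coordinate of Mⁿ(1, 1) is 2ⁿ
-- and the solutions are pairwise distinct.
module Submission where

open import Defs
open import Algebra.Bundles using (RawRing; CommutativeRing)
open import Algebra.Structures using (IsCommutativeRing)
open import Algebra.Morphism.Structures using (IsRingMonomorphism)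
import Algebra.Morphism.RingMonomorphism as RingMonomorphism
import Algebra.Construct.Pointwise as Pointwise
import Algebra.Consequences.Setoid as Consequences
open import Data.Nat as ℕ using (ℕ; zero; suc)
import Data.Nat.Properties as ℕ
open import Data.Nat.Divisibility using (_∣_; divides; _∣?_; ∣1⇒≡1; *-cancelʳ-∣)
open import Data.Nat.Coprimality using (Coprime; coprime-divisor)
open import Data.Nat.Primality using (irreducible[2])
open import Data.Nat.GeneralisedArithmetic using (fold)
import Data.Integer as ℤ
import Data.Integer.Properties as ℤ
open import Data.Rational as ℚ using (ℚ; 0ℚ; 1ℚ; _+_; _*_; -_)
import Data.Rational.Properties as ℚ
open import Data.Rational.Solver using (module +-*-Solver)
open import Data.List using ([]; _∷_; map)
import Data.List.Relation.Unary.All as All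
open import Data.List.Relation.Unary.All using ([]; _∷_)
open import Data.List.Relation.Unary.All.Properties using (map⁺)
open import Data.Maybe using (Maybe; just; nothing)
open import Data.Product using (_×_; _,_; proj₁; proj₂; uncurry; ∃-syntax)
open import Data.Sum using ([_,_]; inj₁; inj₂)
open import Function using (_∘_; id)
open import Relation.Binary.Definitions using (tri<; tri≈; tri>)
open import Relation.Binary.PropositionalEquality
  using (_≡_; refl; sym; trans; cong; cong₂; subst; subst₂; _≗_; _→-setoid_; module ≡-Reasoning)
open import Relation.Nullary using (yes; no; contradiction)
import Tactic.RingSolver.Core.AlmostCommutativeRing as AlmostCommutativeRing
import Tactic.RingSolver.NonReflective as NonReflective

open +-*-Solver using (solve; con; _:+_; _:*_; _:=_)

-- Formal power series over ℚ

Series : Set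
Series = ℕ → ℚ

infixl 6 _+ₛ_
infixl 7 _*ₛ_

_+ₛ_ : Series → Series → Series
(f +ₛ g) i = f i + g i

-ₛ_ : Series → Series
-ₛ f = -_ ∘ f

0ₛ 1ₛ : Series
0ₛ _ = 0ℚ
1ₛ zero    = 1ℚ
1ₛ (suc _) = 0ℚ

tail : Series → Series
tail f = f ∘ suc

_*ₛ_ : Series → Series → Series
(f *ₛ g) zero    = f 0 * g 0
(f *ₛ g) (suc i) = f 0 * g (suc i) + (tail f *ₛ g) i

*ₛ-cong : ∀ {f f′ g g′} → f ≗ f′ → g ≗ g′ → f *ₛ g ≗ f′ *ₛ g′
*ₛ-cong f≗f′ g≗g′ zero    = cong₂ _*_ (f≗f′ 0) (g≗g′ 0)
*ₛ-cong f≗f′ g≗g′ (suc i) =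
  cong₂ _+_ (cong₂ _*_ (f≗f′ 0) (g≗g′ (suc i))) (*ₛ-cong (f≗f′ ∘ suc) g≗g′ i)

*ₛ-zeroˡ : ∀ g → 0ₛ *ₛ g ≗ 0ₛ
*ₛ-zeroˡ g zero    = ℚ.*-zeroˡ (g 0)
*ₛ-zeroˡ g (suc i) = begin
  0ℚ * g (suc i) + (0ₛ *ₛ g) i ≡⟨ cong₂ _+_ (ℚ.*-zeroˡ (g (suc i))) (*ₛ-zeroˡ g i) ⟩
  0ℚ + 0ℚ                      ≡⟨ ℚ.+-identityˡ 0ℚ ⟩
  0ℚ                           ∎
  where open ≡-Reasoning

*ₛ-identityˡ : ∀ g → 1ₛ *ₛ g ≗ g
*ₛ-identityˡ g zero    = ℚ.*-identityˡ (g 0)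
*ₛ-identityˡ g (suc i) = begin
  1ℚ * g (suc i) + (0ₛ *ₛ g) i ≡⟨ cong₂ _+_ (ℚ.*-identityˡ (g (suc i))) (*ₛ-zeroˡ g i) ⟩
  g (suc i) + 0ℚ               ≡⟨ ℚ.+-identityʳ (g (suc i)) ⟩
  g (suc i)                    ∎
  where open ≡-Reasoning

*ₛ-distribʳ : ∀ h f g → (f +ₛ g) *ₛ h ≗ f *ₛ h +ₛ g *ₛ h
*ₛ-distribʳ h f g zero    = ℚ.*-distribʳ-+ (h 0) (f 0) (g 0)
*ₛ-distribʳ h f g (suc i) = begin
  (f 0 + g 0) * h (suc i) + ((tail f +ₛ tail g) *ₛ h) i
    ≡⟨ cong ((f 0 + g 0) * h (suc i) +_) (*ₛ-distribʳ h (tail f) (tail g) i) ⟩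
  (f 0 + g 0) * h (suc i) + ((tail f *ₛ h) i + (tail g *ₛ h) i)
    ≡⟨ solve 5 (λ a b c x y → (a :+ b) :* c :+ (x :+ y) := (a :* c :+ x) :+ (b :* c :+ y))
             refl (f 0) (g 0) (h (suc i)) ((tail f *ₛ h) i) ((tail g *ₛ h) i) ⟩
  (f *ₛ h) (suc i) + (g *ₛ h) (suc i) ∎
  where open ≡-Reasoning

*ₛ-scaleˡ : ∀ c f g → ((c *_) ∘ f) *ₛ g ≗ (c *_) ∘ (f *ₛ g)
*ₛ-scaleˡ c f g zero    = ℚ.*-assoc c (f 0) (g 0)
*ₛ-scaleˡ c f g (suc i) = begin
  c * f 0 * g (suc i) + (((c *_) ∘ tail f) *ₛ g) i
    ≡⟨ cong (c * f 0 * g (suc i) +_) (*ₛ-scaleˡ c (tail f) g i) ⟩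
  c * f 0 * g (suc i) + c * (tail f *ₛ g) i
    ≡⟨ solve 4 (λ c a b x → c :* a :* b :+ c :* x := c :* (a :* b :+ x))
             refl c (f 0) (g (suc i)) ((tail f *ₛ g) i) ⟩
  c * (f *ₛ g) (suc i) ∎
  where open ≡-Reasoning

*ₛ-suc : ∀ f g n → (f *ₛ g) (suc n) ≡ (f *ₛ tail g) n + f (suc n) * g 0
*ₛ-suc f g zero    = refl
*ₛ-suc f g (suc n) = begin
  f 0 * g (suc (suc n)) + (tail f *ₛ g) (suc n)
    ≡⟨ cong (f 0 * g (suc (suc n)) +_) (*ₛ-suc (tail f) g n) ⟩
  f 0 * g (suc (suc n)) + ((tail f *ₛ tail g) n + f (suc (suc n)) * g 0)
    ≡⟨ ℚ.+-assoc (f 0 * g (suc (suc n))) ((tail f *ₛ tail g) n) (f (suc (suc n)) * g 0) ⟨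
  (f *ₛ tail g) (suc n) + f (suc (suc n)) * g 0 ∎
  where open ≡-Reasoning

*ₛ-comm : ∀ f g → f *ₛ g ≗ g *ₛ f
*ₛ-comm f g zero    = ℚ.*-comm (f 0) (g 0)
*ₛ-comm f g (suc n) = begin
  f 0 * g (suc n) + (tail f *ₛ g) n ≡⟨ cong (f 0 * g (suc n) +_) (*ₛ-comm (tail f) g n) ⟩
  f 0 * g (suc n) + (g *ₛ tail f) n ≡⟨ solve 3 (λ a b x → a :* b :+ x := x :+ b :* a)
                                               refl (f 0) (g (suc n)) ((g *ₛ tail f) n) ⟩
  (g *ₛ tail f) n + g (suc n) * f 0 ≡⟨ *ₛ-suc g f n ⟨
  (g *ₛ f) (suc n)                  ∎
  where open ≡-Reasoning

-- tail (f *ₛ g) is definitionally (f 0 *_) ∘ tail g +ₛ tail f *ₛ g.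
*ₛ-assoc : ∀ f g h → (f *ₛ g) *ₛ h ≗ f *ₛ (g *ₛ h)
*ₛ-assoc f g h zero    = ℚ.*-assoc (f 0) (g 0) (h 0)
*ₛ-assoc f g h (suc n) = begin
  f 0 * g 0 * h (suc n) + (((f 0 *_) ∘ tail g +ₛ tail f *ₛ g) *ₛ h) n
    ≡⟨ cong (f 0 * g 0 * h (suc n) +_) (trans
         (*ₛ-distribʳ h ((f 0 *_) ∘ tail g) (tail f *ₛ g) n)
         (cong₂ _+_ (*ₛ-scaleˡ (f 0) (tail g) h n) (*ₛ-assoc (tail f) g h n))) ⟩
  f 0 * g 0 * h (suc n) + (f 0 * (tail g *ₛ h) n + (tail f *ₛ (g *ₛ h)) n)
    ≡⟨ solve 5 (λ a b c x y → a :* b :* c :+ (a :* x :+ y) := a :* (b :* c :+ x) :+ y)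
             refl (f 0) (g 0) (h (suc n)) ((tail g *ₛ h) n) ((tail f *ₛ (g *ₛ h)) n) ⟩
  (f *ₛ (g *ₛ h)) (suc n) ∎
  where open ≡-Reasoning

Series-isCommutativeRing : IsCommutativeRing _≗_ _+ₛ_ _*ₛ_ -ₛ_ 0ₛ 1ₛ
Series-isCommutativeRing = record
  { isRing = record
    { +-isAbelianGroup = Pointwise.isAbelianGroup ℕ ℚ.+-0-isAbelianGroup
    ; *-cong           = *ₛ-cong
    ; *-assoc          = λ f g h → *ₛ-assoc f g h
    ; *-identity       = comm∧idˡ⇒id (λ f g → *ₛ-comm f g) {e = 1ₛ} (λ g → *ₛ-identityˡ g)
    ; distrib          = comm∧distrʳ⇒distr {_∙_ = _*ₛ_} {_◦_ = _+ₛ_}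
                           (λ f≗f′ g≗g′ i → cong₂ _+_ (f≗f′ i) (g≗g′ i))
                           (λ f g → *ₛ-comm f g) (λ h f g → *ₛ-distribʳ h f g)
    }
  ; *-comm = λ f g → *ₛ-comm f g
  }
  where open Consequences (ℕ →-setoid ℚ)

-- Polynomials as a subring of the power series

coeff-+P : ∀ p q → coeff (p +P q) ≗ coeff p +ₛ coeff q
coeff-+P []      q       i       = sym (ℚ.+-identityˡ (coeff q i))
coeff-+P (a ∷ p) []      i       = sym (ℚ.+-identityʳ (coeff (a ∷ p) i))
coeff-+P (a ∷ p) (b ∷ q) zero    = refl
coeff-+P (a ∷ p) (b ∷ q) (suc i) = coeff-+P p q i

coeff-negP : ∀ p → coeff (negP p) ≗ -ₛ coeff p
coeff-negP []      i       = refl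
coeff-negP (a ∷ p) zero    = refl
coeff-negP (a ∷ p) (suc i) = coeff-negP p i

coeff-map-* : ∀ a p → coeff (map (a *_) p) ≗ (a *_) ∘ coeff p
coeff-map-* a []      i       = sym (ℚ.*-zeroʳ a)
coeff-map-* a (b ∷ p) zero    = refl
coeff-map-* a (b ∷ p) (suc i) = coeff-map-* a p i

coeff-*P : ∀ p q → coeff (p *P q) ≗ coeff p *ₛ coeff q
coeff-*P []      q i       = sym (*ₛ-zeroˡ (coeff q) i)
coeff-*P (a ∷ p) q zero    = trans (coeff-+P (map (a *_) q) (0ℚ ∷ p *P q) 0)
                                   (trans (ℚ.+-identityʳ _) (coeff-map-* a q 0))
coeff-*P (a ∷ p) q (suc i) = trans (coeff-+P (map (a *_) q) (0ℚ ∷ p *P q) (suc i))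
                                   (cong₂ _+_ (coeff-map-* a q (suc i)) (coeff-*P p q i))

coeff-oneP : coeff oneP ≗ 1ₛ
coeff-oneP zero    = refl
coeff-oneP (suc i) = refl

Poly-rawRing : RawRing _ _
Poly-rawRing = record
  { Carrier = Poly ; _≈_ = _≈P_ ; _+_ = _+P_ ; _*_ = _*P_ ; -_ = negP ; 0# = [] ; 1# = oneP }

Series-rawRing : RawRing _ _
Series-rawRing = record
  { Carrier = Series ; _≈_ = _≗_ ; _+_ = _+ₛ_ ; _*_ = _*ₛ_ ; -_ = -ₛ_ ; 0# = 0ₛ ; 1# = 1ₛ }

-- p ≈P q is by definition coeff p ≗ coeff q, so coeff is injective for free.
coeff-isRingMonomorphism : IsRingMonomorphism Poly-rawRing Series-rawRing coeff
coeff-isRingMonomorphism = record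
  { isRingHomomorphism = record
    { isSemiringHomomorphism = record
      { isNearSemiringHomomorphism = record
        { +-isMonoidHomomorphism = record
          { isMagmaHomomorphism = record
            { isRelHomomorphism = record { cong = id }
            ; homo = coeff-+P }
          ; ε-homo = λ _ → refl }
        ; *-homo = coeff-*P }
      ; 1#-homo = coeff-oneP }
    ; -‿homo = coeff-negP }
  ; injective = id
  }

Poly-commutativeRing : CommutativeRing _ _
Poly-commutativeRing = record
  { isCommutativeRing =
      RingMonomorphism.isCommutativeRing coeff-isRingMonomorphism Series-isCommutativeRing }

[]≈P? : (p : Poly) → Maybe ([] ≈P p)
[]≈P? []      = just λ _ → refl
[]≈P? (a ∷ p) with a ℚ.≟ 0ℚ | []≈P? p
... | yes a≡0 | just []≈p = just λ { zero → sym a≡0 ; (suc i) → []≈p i }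
... | yes _   | nothing   = nothing
... | no _    | _         = nothing

module PolySolver = NonReflective
  (AlmostCommutativeRing.fromCommutativeRing Poly-commutativeRing []≈P?)

constP : ℚ → Poly
constP q = q ∷ []

t² : Poly
t² = tP *P tP

m₁₁ m₁₂ m₂₂ : Poly
m₁₁ = constP ℚ.½ *P ((t² +P oneP) *P (t² +P constP (ℤ.+ 4 ℚ./ 1)))
m₁₂ = constP ℚ.½ *P (tP *P (t² +P constP (ℤ.+ 3 ℚ./ 1)))
m₂₂ = constP ℚ.½ *P (t² +P oneP)

automorph : Poly × Poly → Poly × Poly
automorph (u , v) = (m₁₁ *P u +P m₁₂ *P v , m₁₂ *P u +P m₂₂ *P v)

-- t is a solver variable rather than the constant tP: the solver folds constants with
-- _+P_ and _*P_, whose results are canonical lists only for constant polynomials, and the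
-- final check is by refl.
s3-automorph : ∀ u v → uncurry s3 (automorph (u , v)) ≈P s3 u v
s3-automorph = PolySolver.solve 3 (λ t u v →
    let s₃ : _ → _ → _
        s₃ x y = t ⊗ x ⊗ x ⊕ ⊝ ((t ⊗ t ⊕ Κ oneP) ⊗ x ⊗ y) ⊕ ⊝ (t ⊗ y ⊗ y)
        n₁₁ = Κ (constP ℚ.½) ⊗ ((t ⊗ t ⊕ Κ oneP) ⊗ (t ⊗ t ⊕ Κ (constP (ℤ.+ 4 ℚ./ 1))))
        n₁₂ = Κ (constP ℚ.½) ⊗ (t ⊗ (t ⊗ t ⊕ Κ (constP (ℤ.+ 3 ℚ./ 1))))
        n₂₂ = Κ (constP ℚ.½) ⊗ (t ⊗ t ⊕ Κ oneP)
    in s₃ (n₁₁ ⊗ u ⊕ n₁₂ ⊗ v) (n₁₂ ⊗ u ⊕ n₂₂ ⊗ v) ⊜ s₃ u v)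
  (λ _ → refl) tP
  where open PolySolver

coeff₀-automorph : ∀ u v → coeff (proj₁ (automorph (u , v))) 0 ≡ coeff u 0 + coeff u 0
coeff₀-automorph u v = begin
  coeff (m₁₁ *P u +P m₁₂ *P v) 0                    ≡⟨ coeff-+P (m₁₁ *P u) (m₁₂ *P v) 0 ⟩
  coeff (m₁₁ *P u) 0 + coeff (m₁₂ *P v) 0           ≡⟨ cong₂ _+_ (coeff-*P m₁₁ u 0) (coeff-*P m₁₂ v 0) ⟩
  coeff m₁₁ 0 * coeff u 0 + coeff m₁₂ 0 * coeff v 0
    ≡⟨ solve 2 (λ x y → (con 1ℚ :+ con 1ℚ) :* x :+ con 0ℚ :* y := x :+ x) refl (coeff u 0) (coeff v 0) ⟩
  coeff u 0 + coeff u 0                             ∎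
  where open ≡-Reasoning

∣2^⇒≡2^ : ∀ k {d} → d ∣ 2 ℕ.^ k → ∃[ j ] d ≡ 2 ℕ.^ j
∣2^⇒≡2^ zero    d∣1 = 0 , ∣1⇒≡1 d∣1
∣2^⇒≡2^ (suc k) {d} d∣2^[1+k] with 2 ∣? d
... | yes (divides e refl)
      with ∣2^⇒≡2^ k {e} (*-cancelʳ-∣ 2 (subst (e ℕ.* 2 ∣_) (ℕ.*-comm 2 (2 ℕ.^ k)) d∣2^[1+k]))
...   | j , refl = suc j , ℕ.*-comm (2 ℕ.^ j) 2
∣2^⇒≡2^ (suc k) {d} d∣2^[1+k] | no 2∤d = ∣2^⇒≡2^ k (coprime-divisor d⊥2 d∣2^[1+k])
  where
  d⊥2 : Coprime d 2
  d⊥2 (c∣d , c∣2) = [ id , (λ { refl → contradiction c∣d 2∤d }) ] (irreducible[2] c∣2)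

↧ₙ-∣ : ∀ r z p q → ℚ.↧ r ℤ.* z ≡ ℚ.↧ p ℤ.* ℚ.↧ q → ℚ.↧ₙ r ∣ ℚ.↧ₙ p ℕ.* ℚ.↧ₙ q
↧ₙ-∣ r z p q eq = divides ℤ.∣ z ∣ (begin
  ℚ.↧ₙ p ℕ.* ℚ.↧ₙ q     ≡⟨ ℤ.abs-* (ℚ.↧ p) (ℚ.↧ q) ⟨
  ℤ.∣ ℚ.↧ p ℤ.* ℚ.↧ q ∣ ≡⟨ cong ℤ.∣_∣ eq ⟨
  ℤ.∣ ℚ.↧ r ℤ.* z ∣     ≡⟨ ℤ.abs-* (ℚ.↧ r) z ⟩
  ℚ.↧ₙ r ℕ.* ℤ.∣ z ∣    ≡⟨ ℕ.*-comm (ℚ.↧ₙ r) ℤ.∣ z ∣ ⟩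
  ℤ.∣ z ∣ ℕ.* ℚ.↧ₙ r    ∎)
  where open ≡-Reasoning

Dyadic-∣ : ∀ {r} p q → ℚ.↧ₙ r ∣ ℚ.↧ₙ p ℕ.* ℚ.↧ₙ q → Dyadic p → Dyadic q → Dyadic r
Dyadic-∣ p q r∣pq (j , ↧p≡2^j) (k , ↧q≡2^k) = ∣2^⇒≡2^ (j ℕ.+ k) (subst (_ ∣_) pq≡2^[j+k] r∣pq)
  where
  pq≡2^[j+k] : ℚ.↧ₙ p ℕ.* ℚ.↧ₙ q ≡ 2 ℕ.^ (j ℕ.+ k)
  pq≡2^[j+k] = trans (cong₂ ℕ._*_ ↧p≡2^j ↧q≡2^k) (sym (ℕ.^-distribˡ-+-* 2 j k))

Dyadic-+ : ∀ p q → Dyadic p → Dyadic q → Dyadic (p + q)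
Dyadic-+ p q = Dyadic-∣ {p + q} p q (↧ₙ-∣ (p + q) _ p q (ℚ.↧-+ p q))

Dyadic-* : ∀ p q → Dyadic p → Dyadic q → Dyadic (p * q)
Dyadic-* p q = Dyadic-∣ {p * q} p q (↧ₙ-∣ (p * q) _ p q (ℚ.↧-* p q))

Dyadic-0ℚ : Dyadic 0ℚ
Dyadic-0ℚ = 0 , refl

InZHalfT-+P : ∀ p q → InZHalfT p → InZHalfT q → InZHalfT (p +P q)
InZHalfT-+P []      q       _         q∈        = q∈
InZHalfT-+P (a ∷ p) []      p∈        _         = p∈
InZHalfT-+P (a ∷ p) (b ∷ q) (a∈ ∷ p∈) (b∈ ∷ q∈) = Dyadic-+ a b a∈ b∈ ∷ InZHalfT-+P p q p∈ q∈

InZHalfT-*P : ∀ p q → InZHalfT p → InZHalfT q → InZHalfT (p *P q)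
InZHalfT-*P []      q _         _  = []
InZHalfT-*P (a ∷ p) q (a∈ ∷ p∈) q∈ =
  InZHalfT-+P (map (a *_) q) (0ℚ ∷ p *P q)
    (map⁺ (All.map (Dyadic-* a _ a∈) q∈)) (Dyadic-0ℚ ∷ InZHalfT-*P p q p∈ q∈)

InZHalfT-tP : InZHalfT tP
InZHalfT-tP = (0 , refl) ∷ (0 , refl) ∷ []

InZHalfT-constP : ∀ {q} → Dyadic q → InZHalfT (constP q)
InZHalfT-constP q∈ = q∈ ∷ []

InZHalfT-½ : InZHalfT (constP ℚ.½)
InZHalfT-½ = InZHalfT-constP (1 , refl)

InZHalfT-t² : InZHalfT t²
InZHalfT-t² = InZHalfT-*P tP tP InZHalfT-tP InZHalfT-tP

InZHalfT-t²+ : ∀ q → Dyadic q → InZHalfT (t² +P constP q)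
InZHalfT-t²+ q q∈ = InZHalfT-+P t² (constP q) InZHalfT-t² (InZHalfT-constP q∈)

InZHalfT-m₁₁ : InZHalfT m₁₁
InZHalfT-m₁₁ = InZHalfT-*P (constP ℚ.½) ((t² +P oneP) *P (t² +P constP (ℤ.+ 4 ℚ./ 1))) InZHalfT-½
  (InZHalfT-*P (t² +P oneP) (t² +P constP (ℤ.+ 4 ℚ./ 1))
     (InZHalfT-t²+ 1ℚ (0 , refl)) (InZHalfT-t²+ (ℤ.+ 4 ℚ./ 1) (0 , refl)))

InZHalfT-m₁₂ : InZHalfT m₁₂
InZHalfT-m₁₂ = InZHalfT-*P (constP ℚ.½) (tP *P (t² +P constP (ℤ.+ 3 ℚ./ 1))) InZHalfT-½
  (InZHalfT-*P tP (t² +P constP (ℤ.+ 3 ℚ./ 1)) InZHalfT-tP (InZHalfT-t²+ (ℤ.+ 3 ℚ./ 1) (0 , refl)))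

InZHalfT-m₂₂ : InZHalfT m₂₂
InZHalfT-m₂₂ = InZHalfT-*P (constP ℚ.½) (t² +P oneP) InZHalfT-½ (InZHalfT-t²+ 1ℚ (0 , refl))

automorph-IsSolution : ∀ x → IsSolution x → IsSolution (automorph x)
automorph-IsSolution (u , v) (u∈ , v∈ , s3≈) =
  InZHalfT-+P (m₁₁ *P u) (m₁₂ *P v) (InZHalfT-*P m₁₁ u InZHalfT-m₁₁ u∈) (InZHalfT-*P m₁₂ v InZHalfT-m₁₂ v∈) ,
  InZHalfT-+P (m₁₂ *P u) (m₂₂ *P v) (InZHalfT-*P m₁₂ u InZHalfT-m₁₂ u∈) (InZHalfT-*P m₂₂ v InZHalfT-m₂₂ v∈) ,
  λ i → trans (s3-automorph u v i) (s3≈ i)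

module _ (a : ℕ → ℚ) where

  <-step⇒<-mono : (∀ n → a n ℚ.< a (suc n)) → ∀ {m n} → m ℕ.< n → a m ℚ.< a n
  <-step⇒<-mono step {m} {suc n} (ℕ.s≤s m≤n) with ℕ.m≤n⇒m<n∨m≡n m≤n
  ... | inj₁ m<n  = ℚ.<-trans (<-step⇒<-mono step m<n) (step n)
  ... | inj₂ refl = step m

  <-mono⇒injective : (∀ {m n} → m ℕ.< n → a m ℚ.< a n) → ∀ {m n} → a m ≡ a n → m ≡ n
  <-mono⇒injective mono {m} {n} am≡an with ℕ.<-cmp m n
  ... | tri< m<n _ _ = contradiction am≡an (ℚ.<⇒≢ (mono m<n))
  ... | tri≈ _ m≡n _ = m≡n
  ... | tri> _ _ n<m = contradiction (sym am≡an) (ℚ.<⇒≢ (mono n<m))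

  doubling-injective : 0ℚ ℚ.< a 0 → (∀ n → a (suc n) ≡ a n + a n) → ∀ {m n} → a m ≡ a n → m ≡ n
  doubling-injective a₀>0 double = <-mono⇒injective (<-step⇒<-mono step)
    where
    positive : ∀ n → 0ℚ ℚ.< a n
    positive zero    = a₀>0
    positive (suc n) =
      subst₂ ℚ._<_ (ℚ.+-identityˡ 0ℚ) (sym (double n)) (ℚ.+-mono-< (positive n) (positive n))

    step : ∀ n → a n ℚ.< a (suc n)
    step n = subst₂ ℚ._<_ (ℚ.+-identityʳ (a n)) (sym (double n)) (ℚ.+-monoʳ-< (a n) (positive n))

solutions : ℕ → Poly × Poly
solutions = fold (oneP , oneP) automorph

solutions-IsSolution : ∀ n → IsSolution (solutions n)
solutions-IsSolution zero    = InZHalfT-constP (0 , refl) , InZHalfT-constP (0 , refl) , λ _ → refl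
solutions-IsSolution (suc n) = automorph-IsSolution (solutions n) (solutions-IsSolution n)

solutions-injective : ∀ m n → solutions m ≈² solutions n → m ≡ n
solutions-injective m n (u≈ , _) = doubling-injective (λ k → coeff (proj₁ (solutions k)) 0)
  (ℚ.positive⁻¹ 1ℚ) (λ k → coeff₀-automorph (proj₁ (solutions k)) (proj₂ (solutions k))) (u≈ 0)

lemma4p1 : InfinitelyMany IsSolution
lemma4p1 = solutions , solutions-IsSolution , solutions-injective
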